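{- Let $k\ge 2$ and $n\ge 1$. For a $k$-colored partition $\lambda=(\lambda_1,\dots,\lambda_t)$ of $n$ define $p_{ -k}(\lambda)=\prod_{j=1}^t p_{ -k}(\lambda_j)$ (depending only on the part sizes), and let $\max p_{ -k}(n)$ be the maximum of $p_{ -k}(\lambda)$ over all $k$-colored partitions $\lambda$ of $n$. Then the maximum is attained exactly at the $k$-colored partitions whose multiset of part sizes is as follows: 1) $k=2$: $(2,2,\dots,2)$ when $n$ is even; $(3,2,\dots,2)$ or $(2,2,\dots,2,1)$ when $n$ is odd. Moreover $\max p_{ -2}(n)=5^{n/2}$ if $n$ is even and $\max p_{ -2}(n)=2\cdot 5^{(n-1)/2}$ if $n$ is odd. 2) $k=3$: $(\underbrace{2,\dots,2}_{m},\underbrace{1,\dots,1}_{l})$ for any $m,l\ge0$ with $2m+l=n$. Moreover $\max p_{ -3}(n)=3^n$. 3) $k\ge 4$: $(1,1,\dots,1)$. Moreover $\max p_{ -k}(n)=k^n$.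
   Context: A $k$-colored partition of $n$ is a partition of $n$ in which each part is assigned one of $k$ colors $1,\dots,k$ (two such are equal iff they have the same multiset of (size, color) pairs). $p_{ -k}(m)$ denotes the number of $k$-colored partitions of $m$, i.e. $\sum_{m\ge0}p_{ -k}(m)q^m=\prod_{i\ge1}(1-q^i)^{ -k}$. -}

module Defs where

open import Data.Nat using (ℕ; zero; suc; _+_; _*_; _∸_; _≤_; _≤ᵇ_)
open import Data.Bool using (if_then_else_)
open import Data.Fin using (Fin)
open import Data.List using (List; []; _∷_; map; replicate; concatMap; upTo)
open import Data.Nat.ListAction using (sum; product)
open import Data.List.Relation.Unary.All using (All)
open import Data.Product using (Σ; ∃; _×_; proj₁)
open import Function.Bundles using (_⇔_)
open import Relation.Binary.PropositionalEquality using (_≡_)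

-- Number of ways to write m as  Σ_i c_i * w_i  with c_i ∈ ℕ, where the
-- list ws enumerates the available part "types" (each with its size w_i ≥ 1).
mutual
  countParts : ℕ → List ℕ → ℕ
  countParts zero    []       = 1
  countParts (suc _) []       = 0
  countParts m       (w ∷ ws) = useType m w ws m

  -- useType m w ws j = Σ_{c=0}^{j} [c*w ≤ m] * countParts (m ∸ c*w) ws
  useType : ℕ → ℕ → List ℕ → ℕ → ℕ
  useType m w ws zero    = countParts m ws
  useType m w ws (suc j) =
    (if (suc j * w) ≤ᵇ m then countParts (m ∸ suc j * w) ws else 0)
    + useType m w ws j

-- The part types of a k-colored partition of m: (size s, color c)
-- for 1 ≤ s ≤ m and k colors; recorded by their sizes (k copies of each s).
colTypes : ℕ → ℕ → List ℕ
colTypes k m = concatMap (λ s → replicate k (suc s)) (upTo m)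

p₋ : ℕ → ℕ → ℕ
p₋ k m = countParts m (colTypes k m)

-- A k-colored partition of n, given as a list of (part size, color) pairs
-- (the order of the list is irrelevant for everything below).
KColPart : ℕ → ℕ → Set
KColPart k n = Σ (List (ℕ × Fin k)) λ ps →
  All (λ p → 1 ≤ proj₁ p) ps × sum (map proj₁ ps) ≡ n

sizes : ∀ {k n} → KColPart k n → List ℕ
sizes λp = map proj₁ (proj₁ λp)

p₋part : ∀ {k n} → KColPart k n → ℕ
p₋part {k} λp = product (map (p₋ k) (sizes λp))

MaxAttainedExactly : (k n M : ℕ) → (List ℕ → Set) → Set
MaxAttainedExactly k n M Shape =
  (∃ λ (λp : KColPart k n) → p₋part λp ≡ M)
  × (∀ (λp : KColPart k n) → p₋part λp ≤ M)
  × (∀ (λp : KColPart k n) → (p₋part λp ≡ M) ⇔ Shape (sizes λp))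

module Submission where

-- Splitting off one part of a given type gives the recurrence of countParts; summing the sizes
-- of all parts of all partitions of m then gives m p₋ₖ(m) = k Σ_{s=1}^{m} s Σ_{c≥1} p₋ₖ(m − c s).
-- Feeding an exponential bound b p₋ₖ(y) ≤ a rʸ for y < m into this identity and summing the
-- geometric series reproduces the bound at m once m is moderately large.  By strong induction this
-- yields p₋ₖ(m) ≤ kᵐ for k ≥ 3, strictly for m ≥ 2 (k ≥ 4) and m ≥ 3 (k = 3, as p₋₃(2) = 9),
-- and 4 p₋₂(m) ≤ 5 · 2ᵐ.  As p₋ₖ(λ) is a product over the parts, for k ≥ 3 it is at most kⁿ, with
-- equality iff every part is one of the exceptional sizes.  For k = 2 we compare p₋₂(λ)² with 5ⁿ
-- part by part, losing a factor 4/5 for each part other than 2, and no further loss exactly when all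
-- parts are 1, 2 or 3; the parity of n then decides whether zero or one part differs from 2.

open import Defs
open import Data.Bool using (true; false; T; if_then_else_)
open import Data.Bool.Properties using (T-≡)
open import Data.Fin as Fin using (Fin)
open import Data.List using (List; []; _∷_; _++_; map; replicate; length; concatMap; upTo; _∷ʳ_)
open import Data.List.Properties using (concatMap-++; applyUpTo-∷ʳ; ++-identityʳ; map-++; map-id)
open import Data.List.Relation.Unary.All as All using (All; []; _∷_)
open import Data.List.Relation.Unary.All.Properties using (++⁺; replicate⁺; map⁺)
open import Data.List.Relation.Binary.Permutation.Propositional
  using (_↭_; ↭-refl; ↭-reflexive; ↭-sym; ↭-trans; prep; swap)
import Data.List.Relation.Binary.Permutation.Propositional.Properties as ↭
open ↭ using (All-resp-↭)
open import Data.Nat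
open import Data.Nat.Induction using (<-rec)
open import Data.Nat.ListAction using (sum; product)
open import Data.Nat.ListAction.Properties using (sum-++; sum-↭; product-++; product-↭)
open import Data.Nat.Properties
open import Data.Nat.Solver using (module +-*-Solver)
open import Data.Product using (Σ; ∃; ∃₂; _×_; _,_; proj₁; proj₂)
open import Data.Sum using (_⊎_; inj₁; inj₂)
open import Data.Unit using (tt)
open import Function.Bundles using (_⇔_; mk⇔; Equivalence)
open import Function.Construct.Composition using (_⇔-∘_)
open import Relation.Binary.PropositionalEquality
open import Relation.Nullary using (yes; no; contradiction)

open +-*-Solver

-- f (m ∸ v) when v ≤ m, and 0 (not f 0) when v > m.
atMinus : (ℕ → ℕ) → ℕ → ℕ → ℕ
atMinus f m       zero    = f m
atMinus f zero    (suc v) = 0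
atMinus f (suc m) (suc v) = atMinus f m v

atMinus-≤ : ∀ f {m v} → v ≤ m → atMinus f m v ≡ f (m ∸ v)
atMinus-≤ f {m} {zero}      _         = refl
atMinus-≤ f {suc m} {suc v} (s≤s v≤m) = atMinus-≤ f v≤m

atMinus-> : ∀ f {m v} → m < v → atMinus f m v ≡ 0
atMinus-> f {zero}  {suc v} _         = refl
atMinus-> f {suc m} {suc v} (s≤s m<v) = atMinus-> f m<v

atMinus-cong : ∀ {f g} m v → (∀ y → f y ≡ g y) → atMinus f m v ≡ atMinus g m v
atMinus-cong {f} {g} m v f≗g with v ≤? m
... | yes v≤m rewrite atMinus-≤ f v≤m | atMinus-≤ g v≤m = f≗g (m ∸ v)
... | no  v≰m rewrite atMinus-> f (≰⇒> v≰m) | atMinus-> g (≰⇒> v≰m) = refl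

atMinus-cong< : ∀ {f g} m v → 0 < v → (∀ {y} → y < m → f y ≡ g y) →
                atMinus f m v ≡ atMinus g m v
atMinus-cong< {f} {g} m v 0<v f≗g with v ≤? m
... | yes v≤m rewrite atMinus-≤ f v≤m | atMinus-≤ g v≤m = f≗g (∸-monoʳ-< 0<v v≤m)
... | no  v≰m rewrite atMinus-> f (≰⇒> v≰m) | atMinus-> g (≰⇒> v≰m) = refl

atMinus-+ : ∀ f g m v → atMinus (λ y → f y + g y) m v ≡ atMinus f m v + atMinus g m v
atMinus-+ f g m       zero    = refl
atMinus-+ f g zero    (suc v) = refl
atMinus-+ f g (suc m) (suc v) = atMinus-+ f g m v

atMinus-* : ∀ c f m v → atMinus (λ y → c * f y) m v ≡ c * atMinus f m v
atMinus-* c f m       zero    = refl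
atMinus-* c f zero    (suc v) = sym (*-zeroʳ c)
atMinus-* c f (suc m) (suc v) = atMinus-* c f m v

atMinus-atMinus : ∀ f m v w → atMinus (λ y → atMinus f y v) m w ≡ atMinus f m (v + w)
atMinus-atMinus f m       v zero    rewrite +-identityʳ v = refl
atMinus-atMinus f zero    v (suc w) rewrite +-suc v w = refl
atMinus-atMinus f (suc m) v (suc w) rewrite +-suc v w = atMinus-atMinus f m v w

atMinus-comm : ∀ f m v w →
               atMinus (λ y → atMinus f y v) m w ≡ atMinus (λ y → atMinus f y w) m v
atMinus-comm f m v w = begin
  atMinus (λ y → atMinus f y v) m w ≡⟨ atMinus-atMinus f m v w ⟩
  atMinus f m (v + w)               ≡⟨ cong (atMinus f m) (+-comm v w) ⟩
  atMinus f m (w + v)               ≡⟨ atMinus-atMinus f m w v ⟨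
  atMinus (λ y → atMinus f y w) m v ∎
  where open ≡-Reasoning

*-atMinus : ∀ f m v → m * atMinus f m v ≡ atMinus (λ y → y * f y) m v + v * atMinus f m v
*-atMinus f m v with v ≤? m
... | yes v≤m rewrite atMinus-≤ f v≤m | atMinus-≤ (λ y → y * f y) v≤m = begin
  m * f (m ∸ v)                     ≡⟨ cong (_* f (m ∸ v)) (m∸n+n≡m v≤m) ⟨
  (m ∸ v + v) * f (m ∸ v)           ≡⟨ *-distribʳ-+ (f (m ∸ v)) (m ∸ v) v ⟩
  (m ∸ v) * f (m ∸ v) + v * f (m ∸ v) ∎
  where open ≡-Reasoning
... | no v≰m rewrite atMinus-> f (≰⇒> v≰m) | atMinus-> (λ y → y * f y) (≰⇒> v≰m) =
  trans (*-zeroʳ m) (sym (*-zeroʳ v))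

-- Partitions with prescribed part types

count : List ℕ → ℕ → ℕ
count ws m = countParts m ws

if-≤ᵇ-yes : ∀ {x m} {a b : ℕ} → x ≤ m → (if x ≤ᵇ m then a else b) ≡ a
if-≤ᵇ-yes x≤m rewrite Equivalence.to T-≡ (≤⇒≤ᵇ x≤m) = refl

if-≤ᵇ-no : ∀ {x m} {a b : ℕ} → m < x → (if x ≤ᵇ m then a else b) ≡ b
if-≤ᵇ-no {x} {m} m<x with x ≤ᵇ m in eq
... | false = refl
... | true  = contradiction (≤ᵇ⇒≤ x m (subst T (sym eq) tt)) (<⇒≱ m<x)

countParts-∷ : ∀ m w ws → countParts m (w ∷ ws) ≡ useType m w ws m
countParts-∷ zero    w ws = refl
countParts-∷ (suc m) w ws = refl

useType-small : ∀ m w ws j → m < suc w → useType m (suc w) ws j ≡ count ws m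
useType-small m w ws zero    _   = refl
useType-small m w ws (suc j) m<w
  rewrite if-≤ᵇ-no {a = count ws (m ∸ suc j * suc w)} {0}
            (<-≤-trans m<w (m≤m+n (suc w) (j * suc w))) = useType-small m w ws j m<w

useType-saturated-+ : ∀ m w ws d → useType m (suc w) ws (d + m) ≡ useType m (suc w) ws m
useType-saturated-+ m w ws zero    = refl
useType-saturated-+ m w ws (suc d)
  rewrite if-≤ᵇ-no {a = count ws (m ∸ suc (d + m) * suc w)} {0}
            (<-≤-trans (s≤s (m≤n+m m d)) (m≤m*n (suc (d + m)) (suc w))) =
  useType-saturated-+ m w ws d

useType-saturated : ∀ m w ws j → m ≤ j → useType m (suc w) ws j ≡ useType m (suc w) ws m
useType-saturated m w ws j m≤j =
  subst (λ i → useType m (suc w) ws i ≡ useType m (suc w) ws m)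
        (m∸n+n≡m m≤j) (useType-saturated-+ m w ws (j ∸ m))

if-≤ᵇ-shift : ∀ (f : ℕ → ℕ) w x m → w ≤ m →
  (if w + x ≤ᵇ m then f (m ∸ (w + x)) else 0) ≡ (if x ≤ᵇ m ∸ w then f (m ∸ w ∸ x) else 0)
if-≤ᵇ-shift f w x m w≤m with x ≤? m ∸ w
... | yes x≤m-w
  rewrite if-≤ᵇ-yes {a = f (m ∸ w ∸ x)} {0} x≤m-w
        | if-≤ᵇ-yes {a = f (m ∸ (w + x))} {0}
            (subst (w + x ≤_) (m+[n∸m]≡n w≤m) (+-monoʳ-≤ w x≤m-w))
        | ∸-+-assoc m w x = refl
... | no x≰m-w
  rewrite if-≤ᵇ-no {a = f (m ∸ w ∸ x)} {0} (≰⇒> x≰m-w)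
        | if-≤ᵇ-no {a = f (m ∸ (w + x))} {0}
            (subst (_< w + x) (m+[n∸m]≡n w≤m) (+-monoʳ-< w (≰⇒> x≰m-w))) = refl

useType-suc : ∀ m w ws → w ≤ m → ∀ j →
              useType m w ws (suc j) ≡ count ws m + useType (m ∸ w) w ws j
useType-suc m w ws w≤m zero
  rewrite +-identityʳ w | if-≤ᵇ-yes {a = count ws (m ∸ w)} {0} w≤m =
  +-comm (count ws (m ∸ w)) (count ws m)
useType-suc m w ws w≤m (suc j)
  rewrite useType-suc m w ws w≤m j | if-≤ᵇ-shift (count ws) w (suc j * w) m w≤m =
  x+[y+z]≡y+[x+z] (if suc j * w ≤ᵇ m ∸ w then count ws (m ∸ w ∸ suc j * w) else 0)
                  (count ws m) (useType (m ∸ w) w ws j)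
  where
  x+[y+z]≡y+[x+z] : ∀ x y z → x + (y + z) ≡ y + (x + z)
  x+[y+z]≡y+[x+z] = solve 3 (λ x y z → x :+ (y :+ z) := y :+ (x :+ z)) refl

-- Either no part has type w, or removing one part of type w leaves a partition of m − w.
count-∷ : ∀ {w} ws m → 0 < w → count (w ∷ ws) m ≡ count ws m + atMinus (count (w ∷ ws)) m w
count-∷ {suc w} ws m _ with suc w ≤? m
... | no w≰m rewrite atMinus-> (count (suc w ∷ ws)) (≰⇒> w≰m) | countParts-∷ m (suc w) ws =
  trans (useType-small m w ws m (≰⇒> w≰m)) (sym (+-identityʳ _))
count-∷ {suc w} ws (suc m) _ | yes w≤m
  rewrite atMinus-≤ (count (suc w ∷ ws)) w≤m | countParts-∷ (suc m ∸ suc w) (suc w) ws =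
  trans (useType-suc (suc m) (suc w) ws w≤m m)
        (cong (count ws (suc m) +_) (useType-saturated (m ∸ w) w ws m (m∸n≤m m w)))

AllPositive : List ℕ → Set
AllPositive = All (0 <_)

count-swap : ∀ {v w} ws → 0 < v → 0 < w → ∀ m → count (v ∷ w ∷ ws) m ≡ count (w ∷ v ∷ ws) m
count-swap {v} {w} ws 0<v 0<w = <-rec _ step
  where
  A = count (v ∷ w ∷ ws)
  B = count (w ∷ v ∷ ws)
  step : ∀ m → (∀ {y} → y < m → A y ≡ B y) → A m ≡ B m
  step m ih = begin
    A m                                                  ≡⟨ count-∷ (w ∷ ws) m 0<v ⟩
    count (w ∷ ws) m + atMinus A m v                     ≡⟨ cong₂ _+_ (count-∷ ws m 0<w) (atMinus-cong< m v 0<v ih) ⟩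
    (c + cw) + atMinus B m v                             ≡⟨ cong ((c + cw) +_) (unfold-B) ⟩
    (c + cw) + (cv + atMinus (λ y → atMinus B y w) m v)  ≡⟨ cong (λ z → (c + cw) + (cv + z)) twice-removed ⟩
    (c + cw) + (cv + atMinus (λ y → atMinus A y v) m w)  ≡⟨ [a+b]+[c+d]≡[a+c]+[b+d] c cw cv _ ⟩
    (c + cv) + (cw + atMinus (λ y → atMinus A y v) m w)  ≡⟨ cong ((c + cv) +_) (unfold-A) ⟨
    (c + cv) + atMinus A m w                             ≡⟨ cong₂ _+_ (sym (count-∷ ws m 0<v)) (atMinus-cong< m w 0<w ih) ⟩
    count (v ∷ ws) m + atMinus B m w                     ≡⟨ count-∷ (v ∷ ws) m 0<w ⟨
    B m                                                  ∎
    where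
    open ≡-Reasoning
    c  = count ws m
    cw = atMinus (count (w ∷ ws)) m w
    cv = atMinus (count (v ∷ ws)) m v
    [a+b]+[c+d]≡[a+c]+[b+d] : ∀ a b c d → (a + b) + (c + d) ≡ (a + c) + (b + d)
    [a+b]+[c+d]≡[a+c]+[b+d] = solve 4 (λ a b c d → (a :+ b) :+ (c :+ d) := (a :+ c) :+ (b :+ d)) refl
    unfold-B : atMinus B m v ≡ cv + atMinus (λ y → atMinus B y w) m v
    unfold-B = trans (atMinus-cong m v (λ y → count-∷ (v ∷ ws) y 0<w))
                         (atMinus-+ (count (v ∷ ws)) (λ y → atMinus B y w) m v)
    unfold-A : atMinus A m w ≡ cw + atMinus (λ y → atMinus A y v) m w
    unfold-A = trans (atMinus-cong m w (λ y → count-∷ (w ∷ ws) y 0<v))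
                         (atMinus-+ (count (w ∷ ws)) (λ y → atMinus A y v) m w)
    twice-removed : atMinus (λ y → atMinus B y w) m v ≡ atMinus (λ y → atMinus A y v) m w
    twice-removed = begin
      atMinus (λ y → atMinus B y w) m v ≡⟨ atMinus-atMinus B m w v ⟩
      atMinus B m (w + v)               ≡⟨ cong (atMinus B m) (+-comm w v) ⟩
      atMinus B m (v + w)               ≡⟨ atMinus-cong< m (v + w) (<-≤-trans 0<v (m≤m+n v w)) ih ⟨
      atMinus A m (v + w)               ≡⟨ atMinus-atMinus A m v w ⟨
      atMinus (λ y → atMinus A y v) m w ∎

∑ : List ℕ → (ℕ → ℕ) → ℕ
∑ L f = sum (map f L)

∑-+ : ∀ L f g → ∑ L (λ v → f v + g v) ≡ ∑ L f + ∑ L g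
∑-+ []      f g = refl
∑-+ (v ∷ L) f g rewrite ∑-+ L f g =
  solve 4 (λ a b c d → (a :+ b) :+ (c :+ d) := (a :+ c) :+ (b :+ d)) refl (f v) (g v) (∑ L f) (∑ L g)

*-∑ : ∀ c L f → c * ∑ L f ≡ ∑ L (λ v → c * f v)
*-∑ c []      f = *-zeroʳ c
*-∑ c (v ∷ L) f = trans (*-distribˡ-+ c (f v) _) (cong (c * f v +_) (*-∑ c L f))

∑-cong : ∀ {L} f g → AllPositive L → (∀ {v} → 0 < v → f v ≡ g v) → ∑ L f ≡ ∑ L g
∑-cong f g []         f≗g = refl
∑-cong f g (0<v ∷ ps) f≗g = cong₂ _+_ (f≗g 0<v) (∑-cong f g ps f≗g)

∑-mono-≤ : ∀ {L} f g → AllPositive L → (∀ {v} → 0 < v → f v ≤ g v) → ∑ L f ≤ ∑ L g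
∑-mono-≤ f g []         f≤g = z≤n
∑-mono-≤ f g (0<v ∷ ps) f≤g = +-mono-≤ (f≤g 0<v) (∑-mono-≤ f g ps f≤g)

∑-++ : ∀ L M f → ∑ (L ++ M) f ≡ ∑ L f + ∑ M f
∑-++ L M f = trans (cong sum (map-++ f L M)) (sum-++ (map f L) (map f M))

∑-replicate : ∀ k x f → ∑ (replicate k x) f ≡ k * f x
∑-replicate zero    x f = refl
∑-replicate (suc k) x f = cong (f x +_) (∑-replicate k x f)

atMinus-∑ : ∀ L (F : ℕ → ℕ → ℕ) m w →
            atMinus (λ y → ∑ L (λ v → F v y)) m w ≡ ∑ L (λ v → atMinus (F v) m w)
atMinus-∑ []      F m w = atMinus-zero m w
  where
  atMinus-zero : ∀ m w → atMinus (λ _ → 0) m w ≡ 0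
  atMinus-zero m       zero    = refl
  atMinus-zero zero    (suc w) = refl
  atMinus-zero (suc m) (suc w) = atMinus-zero m w
atMinus-∑ (v ∷ L) F m w =
  trans (atMinus-+ (F v) _ m w) (cong (atMinus (F v) m w +_) (atMinus-∑ L F m w))

-- Σ_{c ≥ 1} count L (m − c v); when v occurs in L, the total number of parts of type v
-- over all partitions of m.
totalMultiplicity : ℕ → List ℕ → ℕ → ℕ
totalMultiplicity v L m = atMinus (count (v ∷ L)) m v

totalMultiplicity-self : ∀ {w} L m → 0 < w →
  totalMultiplicity w L m ≡ atMinus (count L) m w + atMinus (totalMultiplicity w L) m w
totalMultiplicity-self {w} L m 0<w =
  trans (atMinus-cong m w (λ y → count-∷ L y 0<w)) (atMinus-+ (count L) _ m w)

totalMultiplicity-∷ : ∀ {v w} ws m → 0 < v → 0 < w →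
  totalMultiplicity v (w ∷ ws) m ≡ totalMultiplicity v ws m + atMinus (totalMultiplicity v (w ∷ ws)) m w
totalMultiplicity-∷ {v} {w} ws m 0<v 0<w = begin
  atMinus (count (v ∷ w ∷ ws)) m v
    ≡⟨ atMinus-cong m v (count-swap ws 0<v 0<w) ⟩
  atMinus (count (w ∷ v ∷ ws)) m v
    ≡⟨ atMinus-cong m v (λ y → count-∷ (v ∷ ws) y 0<w) ⟩
  atMinus (λ y → count (v ∷ ws) y + atMinus (count (w ∷ v ∷ ws)) y w) m v
    ≡⟨ atMinus-+ (count (v ∷ ws)) _ m v ⟩
  totalMultiplicity v ws m + atMinus (λ y → atMinus (count (w ∷ v ∷ ws)) y w) m v
    ≡⟨ cong (totalMultiplicity v ws m +_) (atMinus-comm (count (w ∷ v ∷ ws)) m w v) ⟩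
  totalMultiplicity v ws m + atMinus (λ y → atMinus (count (w ∷ v ∷ ws)) y v) m w
    ≡⟨ cong (totalMultiplicity v ws m +_)
            (atMinus-cong m w (λ y → atMinus-cong y v (λ z → sym (count-swap ws 0<v 0<w z)))) ⟩
  totalMultiplicity v ws m + atMinus (totalMultiplicity v (w ∷ ws)) m w ∎
  where open ≡-Reasoning

-- Both sides count the total size of all parts of all partitions of m.
*-count≡∑-totalMultiplicity : ∀ ws → AllPositive ws → ∀ m →
  m * count ws m ≡ ∑ ws (λ v → v * totalMultiplicity v ws m)
*-count≡∑-totalMultiplicity []       _ zero    = refl
*-count≡∑-totalMultiplicity []       _ (suc m) = *-zeroʳ (suc m)
*-count≡∑-totalMultiplicity (w ∷ ws) (0<w ∷ ps) = <-rec _ step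
  where
  L = w ∷ ws
  E = λ v → totalMultiplicity v L
  step : ∀ m → (∀ {y} → y < m → y * count L y ≡ ∑ L (λ v → v * E v y)) →
         m * count L m ≡ ∑ L (λ v → v * E v m)
  step m ih = begin
    m * count L m
      ≡⟨ cong (m *_) (count-∷ ws m 0<w) ⟩
    m * (count ws m + atMinus (count L) m w)
      ≡⟨ *-distribˡ-+ m (count ws m) _ ⟩
    m * count ws m + m * atMinus (count L) m w
      ≡⟨ cong₂ _+_ (*-count≡∑-totalMultiplicity ws ps m) (*-atMinus (count L) m w) ⟩
    a + (atMinus (λ y → y * count L y) m w + d)
      ≡⟨ cong (λ z → a + (z + d)) (atMinus-cong< m w 0<w ih) ⟩
    a + (atMinus (λ y → w * E w y + ∑ ws (λ v → v * E v y)) m w + d)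
      ≡⟨ cong (λ z → a + (z + d)) (trans (atMinus-+ _ _ m w)
           (cong₂ _+_ (atMinus-* w (E w) m w) (atMinus-∑ ws (λ v y → v * E v y) m w))) ⟩
    a + ((b + ∑ ws (λ v → atMinus (λ y → v * E v y) m w)) + d)
      ≡⟨ cong (λ z → a + ((b + z) + d)) (∑-cong _ _ ps (λ {v} _ → atMinus-* v (E v) m w)) ⟩
    a + ((b + c) + d)
      ≡⟨ solve 4 (λ a b c d → a :+ ((b :+ c) :+ d) := (d :+ b) :+ (a :+ c)) refl a b c d ⟩
    (d + b) + (a + c)
      ≡⟨ cong₂ _+_ head tail ⟨
    w * E w m + ∑ ws (λ v → v * E v m) ∎
    where
    open ≡-Reasoning
    a = ∑ ws (λ v → v * totalMultiplicity v ws m)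
    b = w * atMinus (E w) m w
    c = ∑ ws (λ v → v * atMinus (E v) m w)
    d = w * atMinus (count L) m w
    head : w * E w m ≡ d + b
    head = trans (cong (w *_) (totalMultiplicity-self L m 0<w)) (*-distribˡ-+ w _ _)
    tail : ∑ ws (λ v → v * E v m) ≡ a + c
    tail = trans (∑-cong _ _ ps (λ {v} 0<v → trans (cong (v *_) (totalMultiplicity-∷ ws m 0<v 0<w))
                                                   (*-distribˡ-+ v _ _)))
                 (∑-+ ws _ _)

count-++-large : ∀ ws → AllPositive ws → ∀ y vs → All (y <_) vs → count (ws ++ vs) y ≡ count ws y
count-++-large [] _ y [] [] = refl
count-++-large [] _ y (v ∷ vs) (y<v ∷ ps) = begin
  count (v ∷ vs) y                    ≡⟨ count-∷ vs y (≤-trans (s≤s z≤n) y<v) ⟩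
  count vs y + atMinus _ y v          ≡⟨ cong (count vs y +_) (atMinus-> _ y<v) ⟩
  count vs y + 0                      ≡⟨ +-identityʳ _ ⟩
  count vs y                          ≡⟨ count-++-large [] [] y vs ps ⟩
  count [] y                          ∎
  where open ≡-Reasoning
count-++-large (w ∷ ws) (0<w ∷ pws) = <-rec _ step
  where
  step : ∀ y → (∀ {y′} → y′ < y → ∀ vs → All (y′ <_) vs → count (w ∷ ws ++ vs) y′ ≡ count (w ∷ ws) y′) →
         ∀ vs → All (y <_) vs → count (w ∷ ws ++ vs) y ≡ count (w ∷ ws) y
  step y ih vs ps = begin
    count (w ∷ ws ++ vs) y                              ≡⟨ count-∷ (ws ++ vs) y 0<w ⟩
    count (ws ++ vs) y + atMinus (count (w ∷ ws ++ vs)) y w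
      ≡⟨ cong₂ _+_ (count-++-large ws pws y vs ps)
                   (atMinus-cong< y w 0<w (λ y′<y → ih y′<y vs (All.map (<-trans y′<y) ps))) ⟩
    count ws y + atMinus (count (w ∷ ws)) y w           ≡⟨ count-∷ ws y 0<w ⟨
    count (w ∷ ws) y                                    ∎
    where open ≡-Reasoning

colTypes-suc : ∀ k N → colTypes k (suc N) ≡ colTypes k N ++ replicate k (suc N)
colTypes-suc k N = begin
  concatMap part (upTo (suc N))            ≡⟨ cong (concatMap part) (applyUpTo-∷ʳ (λ x → x) N) ⟨
  concatMap part (upTo N ∷ʳ N)             ≡⟨ concatMap-++ part (upTo N) (N ∷ []) ⟩
  colTypes k N ++ (replicate k (suc N) ++ []) ≡⟨ cong (colTypes k N ++_) (++-identityʳ _) ⟩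
  colTypes k N ++ replicate k (suc N)      ∎
  where
  open ≡-Reasoning
  part = λ s → replicate k (suc s)

colTypes-positive : ∀ k N → AllPositive (colTypes k N)
colTypes-positive k zero = []
colTypes-positive k (suc N) rewrite colTypes-suc k N =
  ++⁺ (colTypes-positive k N) (replicate⁺ k (s≤s z≤n))

-- colTypes k N extends colTypes k y only by types of size > y, which fit in no partition of y.
count-colTypes : ∀ k y N → y ≤ N → count (colTypes k N) y ≡ p₋ k y
count-colTypes k y zero    z≤n  = refl
count-colTypes k y (suc N) y≤1+N with y ≤? N
... | yes y≤N rewrite colTypes-suc k N =
  trans (count-++-large (colTypes k N) (colTypes-positive k N) y (replicate k (suc N)) (replicate⁺ k (s≤s y≤N)))
        (count-colTypes k y N y≤N)
... | no y≰N rewrite ≤-antisym y≤1+N (≰⇒> y≰N) = refl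

sum₁ : (ℕ → ℕ) → ℕ → ℕ
sum₁ F zero    = 0
sum₁ F (suc N) = sum₁ F N + F (suc N)

∑-colTypes : ∀ k N F → ∑ (colTypes k N) F ≡ k * sum₁ F N
∑-colTypes k zero    F = sym (*-zeroʳ k)
∑-colTypes k (suc N) F rewrite colTypes-suc k N
  | ∑-++ (colTypes k N) (replicate k (suc N)) F | ∑-colTypes k N F | ∑-replicate k (suc N) F =
  sym (*-distribˡ-+ k _ _)

-- Exponential bounds on p₋ₖ

atMinus-^-suc≤ : ∀ r m v → 0 < v → atMinus (λ z → suc r ^ suc z) m v ≤ suc r ^ m
atMinus-^-suc≤ r zero    (suc v) _ = z≤n
atMinus-^-suc≤ r (suc m) (suc v) _ with v ≤? m
... | yes v≤m rewrite atMinus-≤ (λ z → suc r ^ suc z) v≤m = ^-monoʳ-≤ (suc r) (s≤s (m∸n≤m m v))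
... | no  v≰m rewrite atMinus-> (λ z → suc r ^ suc z) (≰⇒> v≰m) = z≤n

-- Σ_{c ≥ 1} r^(y − c v) ≤ r^(y − v + 1) / t for r = t + 1.
totalMultiplicity-bound : ∀ a b t L v m → 0 < v → (∀ {y} → y < m → b * count L y ≤ a * suc t ^ y) →
  ∀ y → y ≤ m → b * t * totalMultiplicity v L y ≤ a * atMinus (λ z → suc t ^ suc z) y v
totalMultiplicity-bound a b t L v m 0<v bound = <-rec _ step
  where
  r = suc t
  E = totalMultiplicity v L
  step : ∀ y → (∀ {y′} → y′ < y → y′ ≤ m → b * t * E y′ ≤ a * atMinus (λ z → r ^ suc z) y′ v) →
         y ≤ m → b * t * E y ≤ a * atMinus (λ z → r ^ suc z) y v
  step y ih y≤m with v ≤? y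
  ... | no v≰y rewrite totalMultiplicity-self L y 0<v
        | atMinus-> (count L) (≰⇒> v≰y) | atMinus-> E (≰⇒> v≰y) | *-zeroʳ (b * t) = z≤n
  ... | yes v≤y rewrite totalMultiplicity-self L y 0<v
        | atMinus-≤ (count L) v≤y | atMinus-≤ E v≤y | atMinus-≤ (λ z → r ^ suc z) v≤y = begin
    b * t * (count L w + E w)
      ≡⟨ solve 4 (λ b t x e → b :* t :* (x :+ e) := t :* (b :* x) :+ b :* t :* e) refl b t (count L w) (E w) ⟩
    t * (b * count L w) + b * t * E w
      ≤⟨ +-mono-≤ (*-monoʳ-≤ t (bound w<m)) (ih w<y (≤-trans (m∸n≤m y v) y≤m)) ⟩
    t * (a * r ^ w) + a * atMinus (λ z → r ^ suc z) w v
      ≤⟨ +-monoʳ-≤ (t * (a * r ^ w)) (*-monoʳ-≤ a (atMinus-^-suc≤ t w v 0<v)) ⟩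
    t * (a * r ^ w) + a * r ^ w
      ≡⟨ solve 3 (λ t a x → t :* (a :* x) :+ a :* x := a :* ((con 1 :+ t) :* x)) refl t a (r ^ w) ⟩
    a * r ^ suc w ∎
    where
    open ≤-Reasoning
    w = y ∸ v
    w<y : w < y
    w<y = ∸-monoʳ-< 0<v v≤y
    w<m : w < m
    w<m = <-≤-trans w<y y≤m

sum₁-cong : ∀ F G N → (∀ {s} → s ≤ N → F s ≡ G s) → sum₁ F N ≡ sum₁ G N
sum₁-cong F G zero    F≗G = refl
sum₁-cong F G (suc N) F≗G = cong₂ _+_ (sum₁-cong F G N (λ s≤N → F≗G (m≤n⇒m≤1+n s≤N))) (F≗G ≤-refl)

sum₁-* : ∀ c F N → sum₁ (λ s → c * F s) N ≡ c * sum₁ F N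
sum₁-* c F zero    = sym (*-zeroʳ c)
sum₁-* c F (suc N) rewrite sum₁-* c F N = sym (*-distribˡ-+ c _ _)

weightedPowerSum : ℕ → ℕ → ℕ
weightedPowerSum r m = sum₁ (λ s → s * atMinus (r ^_) m s) m

weightedPowerSum-suc : ∀ r m → weightedPowerSum r (suc m) ≡ r * weightedPowerSum r m + suc m
weightedPowerSum-suc r m = cong₂ _+_ shifted last
  where
  shifted : sum₁ (λ s → s * atMinus (r ^_) (suc m) s) m ≡ r * weightedPowerSum r m
  shifted = trans (sum₁-cong _ _ m (λ {s} s≤m → begin
      s * atMinus (r ^_) (suc m) s ≡⟨ cong (s *_) (atMinus-≤ (r ^_) (m≤n⇒m≤1+n s≤m)) ⟩
      s * r ^ (suc m ∸ s)          ≡⟨ cong (λ e → s * r ^ e) (+-∸-assoc 1 s≤m) ⟩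
      s * (r * r ^ (m ∸ s))        ≡⟨ cong (λ e → s * (r * e)) (atMinus-≤ (r ^_) s≤m) ⟨
      s * (r * atMinus (r ^_) m s) ≡⟨ solve 3 (λ s r x → s :* (r :* x) := r :* (s :* x)) refl s r _ ⟩
      r * (s * atMinus (r ^_) m s) ∎))
    (sum₁-* r (λ s → s * atMinus (r ^_) m s) m)
    where open ≡-Reasoning
  last : suc m * atMinus (r ^_) (suc m) (suc m) ≡ suc m
  last = trans (cong (suc m *_) (trans (atMinus-≤ (r ^_) (≤-refl {suc m})) (cong (r ^_) (n∸n≡0 (suc m)))))
               (*-identityʳ (suc m))

-- The closed form (r^(m+1) − (m+1) r + m) / (r − 1)², with r = t + 1 and the subtraction moved across.
weightedPowerSum-closed : ∀ t m → t * t * weightedPowerSum (suc t) m + suc m * suc t ≡ suc t ^ suc m + m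
weightedPowerSum-closed t zero =
  solve 1 (λ t → t :* t :* con 0 :+ (con 1 :+ con 0) :* (con 1 :+ t) := (con 1 :+ t) :* con 1 :+ con 0) refl t
weightedPowerSum-closed t (suc m) = +-cancelʳ-≡ K _ _ (begin
  t * t * V (suc m) + suc (suc m) * r + K
    ≡⟨ cong (λ z → t * t * z + suc (suc m) * r + K) (weightedPowerSum-suc r m) ⟩
  t * t * (r * V m + suc m) + suc (suc m) * r + K
    ≡⟨ solve 3 (λ t v m → t :* t :* ((con 1 :+ t) :* v :+ (con 1 :+ m)) :+ (con 2 :+ m) :* (con 1 :+ t)
                          :+ (con 1 :+ m) :* (con 1 :+ t) :* (con 1 :+ t)
                       := (con 1 :+ t) :* (t :* t :* v :+ (con 1 :+ m) :* (con 1 :+ t))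
                          :+ (t :* t :* (con 1 :+ m) :+ (con 2 :+ m) :* (con 1 :+ t))) refl t (V m) m ⟩
  r * (t * t * V m + suc m * r) + R
    ≡⟨ cong (λ z → r * z + R) (weightedPowerSum-closed t m) ⟩
  r * (r ^ suc m + m) + R
    ≡⟨ solve 3 (λ t x m → (con 1 :+ t) :* (x :+ m) :+ (t :* t :* (con 1 :+ m) :+ (con 2 :+ m) :* (con 1 :+ t))
                       := (con 1 :+ t) :* x :+ (con 1 :+ m) :+ (con 1 :+ m) :* (con 1 :+ t) :* (con 1 :+ t))
            refl t (r ^ suc m) m ⟩
  r ^ suc (suc m) + suc m + K ∎)
  where
  open ≡-Reasoning
  r = suc t
  V = weightedPowerSum r
  K = suc m * r * r
  R = t * t * suc m + suc (suc m) * r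

weightedPowerSum-bound : ∀ t m → t * t * weightedPowerSum (suc t) m ≤ suc t ^ suc m
weightedPowerSum-bound t m = +-cancelʳ-≤ (suc m * suc t) _ _ (begin
  t * t * weightedPowerSum (suc t) m + suc m * suc t ≡⟨ weightedPowerSum-closed t m ⟩
  suc t ^ suc m + m                                   ≤⟨ +-monoʳ-≤ (suc t ^ suc m) (≤-trans (n≤1+n m) (m≤m*n (suc m) (suc t))) ⟩
  suc t ^ suc m + suc m * suc t                       ∎)
  where open ≤-Reasoning

-- m p₋ₖ(m) = k Σ_{s=1}^{m} s · (total multiplicity of a size-s type), each multiplicity being
-- at most (a / b t) r^(m − s + 1).
p₋-bound-step : ∀ k a b t m → (∀ {y} → y < m → b * p₋ k y ≤ a * suc t ^ y) →
                t * t * (b * t * (m * p₋ k m)) ≤ a * k * suc t ^ suc (suc m)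
p₋-bound-step k a b t m bound = begin
  t * t * (b * t * (m * p₋ k m))
    ≡⟨ cong (λ z → t * t * (b * t * z)) (*-count≡∑-totalMultiplicity L (colTypes-positive k m) m) ⟩
  t * t * (b * t * ∑ L (λ v → v * E v m))
    ≡⟨ cong (t * t *_) (*-∑ (b * t) L _) ⟩
  t * t * ∑ L (λ v → b * t * (v * E v m))
    ≤⟨ *-monoʳ-≤ (t * t) (∑-mono-≤ _ _ (colTypes-positive k m) per-type) ⟩
  t * t * ∑ L (λ v → a * r * (v * atMinus (r ^_) m v))
    ≡⟨ cong (t * t *_) (trans (sym (*-∑ (a * r) L _)) (cong (a * r *_) (∑-colTypes k m _))) ⟩
  t * t * (a * r * (k * weightedPowerSum r m))
    ≡⟨ solve 5 (λ t a r k v → t :* t :* (a :* r :* (k :* v)) := a :* k :* (r :* (t :* t :* v)))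
             refl t a r k (weightedPowerSum r m) ⟩
  a * k * (r * (t * t * weightedPowerSum r m))
    ≤⟨ *-monoʳ-≤ (a * k) (*-monoʳ-≤ r (weightedPowerSum-bound t m)) ⟩
  a * k * r ^ suc (suc m) ∎
  where
  open ≤-Reasoning
  r = suc t
  L = colTypes k m
  E = λ v → totalMultiplicity v L
  bound′ : ∀ {y} → y < m → b * count L y ≤ a * r ^ y
  bound′ {y} y<m rewrite count-colTypes k y m (<⇒≤ y<m) = bound y<m
  per-type : ∀ {v} → 0 < v → b * t * (v * E v m) ≤ a * r * (v * atMinus (r ^_) m v)
  per-type {v} 0<v = begin
    b * t * (v * E v m)
      ≡⟨ solve 4 (λ b t v e → b :* t :* (v :* e) := v :* (b :* t :* e)) refl b t v (E v m) ⟩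
    v * (b * t * E v m)
      ≤⟨ *-monoʳ-≤ v (totalMultiplicity-bound a b t L v m 0<v bound′ m ≤-refl) ⟩
    v * (a * atMinus (λ z → r ^ suc z) m v)
      ≡⟨ cong (λ z → v * (a * z)) (atMinus-* r (r ^_) m v) ⟩
    v * (a * (r * atMinus (r ^_) m v))
      ≡⟨ solve 4 (λ v a r x → v :* (a :* (r :* x)) := a :* r :* (v :* x)) refl v a r (atMinus (r ^_) m v) ⟩
    a * r * (v * atMinus (r ^_) m v) ∎

≤-byComputation : ∀ {x y} {_ : T (x ≤ᵇ y)} → x ≤ y
≤-byComputation {x} {y} {x≤ᵇy} = ≤ᵇ⇒≤ x y x≤ᵇy

count-zero : ∀ ws → count ws 0 ≡ 1
count-zero []       = refl
count-zero (w ∷ ws) = count-zero ws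

p₋-positive : ∀ k m → 0 < p₋ (suc k) m
p₋-positive k zero    = s≤s z≤n
p₋-positive k (suc m) = count-1∷-positive (replicate k 1 ++ _) (suc m)
  where
  count-1∷-positive : ∀ L m → 0 < count (1 ∷ L) m
  count-1∷-positive L zero    rewrite count-zero L = s≤s z≤n
  count-1∷-positive L (suc m) rewrite count-∷ {1} L (suc m) (s≤s z≤n) =
    ≤-trans (count-1∷-positive L m) (m≤n+m _ _)

4*p₋₂≤5*2^ : ∀ m → 4 * p₋ 2 m ≤ 5 * 2 ^ m
4*p₋₂≤5*2^ = <-rec _ step
  where
  step : ∀ m → (∀ {y} → y < m → 4 * p₋ 2 y ≤ 5 * 2 ^ y) → 4 * p₋ 2 m ≤ 5 * 2 ^ m
  step 0 _ = ≤-byComputation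
  step 1 _ = ≤-byComputation
  step 2 _ = ≤-byComputation
  step 3 _ = ≤-byComputation
  step 4 _ = ≤-byComputation
  step 5 _ = ≤-byComputation
  step 6 _ = ≤-byComputation
  step 7 _ = ≤-byComputation
  step m@(suc (suc (suc (suc (suc (suc (suc (suc j)))))))) ih = *-cancelˡ-≤ m (begin
    m * (4 * p₋ 2 m)              ≡⟨ solve 2 (λ m p → m :* (con 4 :* p) := con 1 :* con 1 :* (con 4 :* con 1 :* (m :* p))) refl m (p₋ 2 m) ⟩
    1 * 1 * (4 * 1 * (m * p₋ 2 m)) ≤⟨ p₋-bound-step 2 5 4 1 m ih ⟩
    5 * 2 * 2 ^ suc (suc m)        ≡⟨ solve 1 (λ x → con 5 :* con 2 :* (con 2 :* (con 2 :* x)) := con 8 :* (con 5 :* x)) refl (2 ^ m) ⟩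
    8 * (5 * 2 ^ m)                ≤⟨ *-monoˡ-≤ (5 * 2 ^ m) (m≤m+n 8 j) ⟩
    m * (5 * 2 ^ m)                ∎)
    where open ≤-Reasoning

125*4^<64*5^ : ∀ j → 125 * 4 ^ (4 + j) < 64 * 5 ^ (4 + j)
125*4^<64*5^ zero    = ≤-byComputation
125*4^<64*5^ (suc j) = begin-strict
  125 * 4 ^ (5 + j)        ≡⟨ solve 1 (λ x → con 125 :* (con 4 :* x) := con 4 :* (con 125 :* x)) refl (4 ^ (4 + j)) ⟩
  4 * (125 * 4 ^ (4 + j))  <⟨ *-monoʳ-< 4 (125*4^<64*5^ j) ⟩
  4 * (64 * 5 ^ (4 + j))   ≤⟨ *-monoˡ-≤ (64 * 5 ^ (4 + j)) (n≤1+n 4) ⟩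
  5 * (64 * 5 ^ (4 + j))   ≡⟨ solve 1 (λ x → con 5 :* (con 64 :* x) := con 64 :* (con 5 :* x)) refl (5 ^ (4 + j)) ⟩
  64 * 5 ^ (5 + j)         ∎
  where open ≤-Reasoning

2^*2^≡4^ : ∀ a → 2 ^ a * 2 ^ a ≡ 4 ^ a
2^*2^≡4^ zero    = refl
2^*2^≡4^ (suc a) rewrite sym (2^*2^≡4^ a) =
  solve 1 (λ x → con 2 :* x :* (con 2 :* x) := con 4 :* (x :* x)) refl (2 ^ a)

5*p₋₂²<4*5^ : ∀ j → 5 * (p₋ 2 (4 + j) * p₋ 2 (4 + j)) < 4 * 5 ^ (4 + j)
5*p₋₂²<4*5^ j = *-cancelˡ-< 16 _ _ (begin-strict
  16 * (5 * (p * p))        ≡⟨ solve 1 (λ p → con 16 :* (con 5 :* (p :* p)) := con 5 :* ((con 4 :* p) :* (con 4 :* p))) refl p ⟩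
  5 * ((4 * p) * (4 * p))   ≤⟨ *-monoʳ-≤ 5 (*-mono-≤ (4*p₋₂≤5*2^ a) (4*p₋₂≤5*2^ a)) ⟩
  5 * ((5 * 2 ^ a) * (5 * 2 ^ a)) ≡⟨ solve 1 (λ x → con 5 :* ((con 5 :* x) :* (con 5 :* x)) := con 125 :* (x :* x)) refl (2 ^ a) ⟩
  125 * (2 ^ a * 2 ^ a)     ≡⟨ cong (125 *_) (2^*2^≡4^ a) ⟩
  125 * 4 ^ a               <⟨ 125*4^<64*5^ j ⟩
  64 * 5 ^ a                ≡⟨ solve 1 (λ x → con 64 :* x := con 16 :* (con 4 :* x)) refl (5 ^ a) ⟩
  16 * (4 * 5 ^ a)          ∎)
  where
  open ≤-Reasoning
  a = 4 + j
  p = p₋ 2 a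

p₋<^-step : ∀ t m → suc t * suc t * suc t < t * t * t * m →
            (∀ {y} → y < m → p₋ (suc t) y ≤ suc t ^ y) → p₋ (suc t) m < suc t ^ m
p₋<^-step t m k³<t³m ih = *-cancelˡ-< (t * t * t * m) _ _ (begin-strict
  t * t * t * m * p₋ k m     ≡⟨ solve 3 (λ t m p → t :* t :* t :* m :* p := t :* t :* (con 1 :* t :* (m :* p))) refl t m (p₋ k m) ⟩
  t * t * (1 * t * (m * p₋ k m)) ≤⟨ p₋-bound-step k 1 1 t m (λ y<m → *-monoʳ-≤ 1 (ih y<m)) ⟩
  1 * k * k ^ suc (suc m)    ≡⟨ solve 2 (λ k x → con 1 :* k :* (k :* (k :* x)) := k :* k :* k :* x) refl k (k ^ m) ⟩
  k * k * k * k ^ m          <⟨ *-monoˡ-< (k ^ m) {{m^n≢0 k m}} k³<t³m ⟩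
  t * t * t * m * k ^ m      ∎)
  where
  open ≤-Reasoning
  k = suc t

p₋₃≤3^ : ∀ m → p₋ 3 m ≤ 3 ^ m
p₋₃≤3^ = <-rec _ step
  where
  step : ∀ m → (∀ {y} → y < m → p₋ 3 y ≤ 3 ^ y) → p₋ 3 m ≤ 3 ^ m
  step 0 _ = ≤-byComputation
  step 1 _ = ≤-byComputation
  step 2 _ = ≤-byComputation
  step 3 _ = ≤-byComputation
  step (suc (suc (suc (suc j)))) ih =
    <⇒≤ (p₋<^-step 2 (4 + j) (≤-trans ≤-byComputation (*-monoʳ-≤ 8 (m≤m+n 4 j))) ih)

p₋₃<3^ : ∀ j → p₋ 3 (3 + j) < 3 ^ (3 + j)
p₋₃<3^ zero    = ≤-byComputation
p₋₃<3^ (suc j) = p₋<^-step 2 (4 + j) (≤-trans ≤-byComputation (*-monoʳ-≤ 8 (m≤m+n 4 j))) (λ {y} _ → p₋₃≤3^ y)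

p₋-one : ∀ k → p₋ k 1 ≡ k
p₋-one k = begin
  p₋ k 1                                     ≡⟨ *-identityˡ (p₋ k 1) ⟨
  1 * p₋ k 1                                 ≡⟨ *-count≡∑-totalMultiplicity L (colTypes-positive k 1) 1 ⟩
  ∑ L (λ v → v * totalMultiplicity v L 1)    ≡⟨ ∑-colTypes k 1 _ ⟩
  k * (1 * count (1 ∷ L) 0)                  ≡⟨ cong (λ z → k * (1 * z)) (count-zero (1 ∷ L)) ⟩
  k * 1                                      ≡⟨ *-identityʳ k ⟩
  k                                          ∎
  where
  open ≡-Reasoning
  L = colTypes k 1

2*p₋-two : ∀ k → 2 * p₋ k 2 ≡ k * (k + 3)
2*p₋-two k = begin
  2 * p₋ k 2                                               ≡⟨ *-count≡∑-totalMultiplicity L (colTypes-positive k 2) 2 ⟩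
  ∑ L (λ v → v * totalMultiplicity v L 2)                  ≡⟨ ∑-colTypes k 2 _ ⟩
  k * ((0 + 1 * count (1 ∷ L) 1) + 2 * count (2 ∷ L) 0)    ≡⟨ cong₂ (λ x y → k * ((0 + 1 * x) + 2 * y)) count-1∷ (count-zero (2 ∷ L)) ⟩
  k * ((0 + 1 * (k + 1)) + 2 * 1)                          ≡⟨ solve 1 (λ k → k :* ((con 0 :+ con 1 :* (k :+ con 1)) :+ con 2 :* con 1) := k :* (k :+ con 3)) refl k ⟩
  k * (k + 3)                                              ∎
  where
  open ≡-Reasoning
  L = colTypes k 2
  count-1∷ : count (1 ∷ L) 1 ≡ k + 1
  count-1∷ = trans (count-∷ {1} L 1 (s≤s z≤n))
                   (cong₂ _+_ (trans (count-colTypes k 1 2 (s≤s z≤n)) (p₋-one k)) (count-zero (1 ∷ L)))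

p₋<^-two : ∀ u → p₋ (4 + u) 2 < (4 + u) ^ 2
p₋<^-two u = *-cancelˡ-< 2 _ _ (begin-strict
  2 * p₋ k 2                    ≡⟨ 2*p₋-two k ⟩
  k * (k + 3)                   <⟨ m<m+n (k * (k + 3)) {k * (1 + u)} (s≤s z≤n) ⟩
  k * (k + 3) + k * (1 + u)     ≡⟨ solve 1 (λ u → (con 4 :+ u) :* ((con 4 :+ u) :+ con 3) :+ (con 4 :+ u) :* (con 1 :+ u)
                                                 := con 2 :* ((con 4 :+ u) :* ((con 4 :+ u) :* con 1))) refl u ⟩
  2 * k ^ 2                     ∎)
  where
  open ≤-Reasoning
  k = 4 + u

[4+u]³<[3+u]³*3 : ∀ u → (4 + u) * (4 + u) * (4 + u) < (3 + u) * (3 + u) * (3 + u) * 3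
[4+u]³<[3+u]³*3 u = begin-strict
  k * k * k                 <⟨ m<m+n (k * k * k) {17 + 33 * u + 15 * (u * u) + 2 * (u * u * u)} (s≤s z≤n) ⟩
  k * k * k + (17 + 33 * u + 15 * (u * u) + 2 * (u * u * u))
    ≡⟨ solve 1 (λ u → (con 4 :+ u) :* (con 4 :+ u) :* (con 4 :+ u)
                       :+ (con 17 :+ con 33 :* u :+ con 15 :* (u :* u) :+ con 2 :* (u :* u :* u))
                    := (con 3 :+ u) :* (con 3 :+ u) :* (con 3 :+ u) :* con 3) refl u ⟩
  t * t * t * 3             ∎
  where
  open ≤-Reasoning
  k = 4 + u
  t = 3 + u

p₋<^-large : ∀ u j → (∀ {y} → y < 3 + j → p₋ (4 + u) y ≤ (4 + u) ^ y) → p₋ (4 + u) (3 + j) < (4 + u) ^ (3 + j)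
p₋<^-large u j = p₋<^-step (3 + u) (3 + j)
  (<-≤-trans ([4+u]³<[3+u]³*3 u) (*-monoʳ-≤ ((3 + u) * (3 + u) * (3 + u)) (m≤m+n 3 j)))

p₋≤^ : ∀ u m → p₋ (4 + u) m ≤ (4 + u) ^ m
p₋≤^ u = <-rec _ step
  where
  k = 4 + u
  step : ∀ m → (∀ {y} → y < m → p₋ k y ≤ k ^ y) → p₋ k m ≤ k ^ m
  step 0                   _  = ≤-refl
  step 1                   _  = ≤-reflexive (trans (p₋-one k) (sym (*-identityʳ k)))
  step 2                   _  = <⇒≤ (p₋<^-two u)
  step (suc (suc (suc j))) ih = <⇒≤ (p₋<^-large u j ih)

p₋<^ : ∀ u j → p₋ (4 + u) (2 + j) < (4 + u) ^ (2 + j)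
p₋<^ u zero    = p₋<^-two u
p₋<^ u (suc j) = p₋<^-large u j (λ {y} _ → p₋≤^ u y)

-- Products over the parts of a partition

∏ : List ℕ → (ℕ → ℕ) → ℕ
∏ L f = product (map f L)

∏-positive : ∀ {L} f → AllPositive L → (∀ {x} → 0 < x → 0 < f x) → 0 < ∏ L f
∏-positive f []         _   = s≤s z≤n
∏-positive f (0<x ∷ ps) f>0 = *-mono-< (f>0 0<x) (∏-positive f ps f>0)

∏-mono-≤ : ∀ {L} f g → AllPositive L → (∀ {x} → 0 < x → f x ≤ g x) → ∏ L f ≤ ∏ L g
∏-mono-≤ f g []         _   = ≤-refl
∏-mono-≤ f g (0<x ∷ ps) f≤g = *-mono-≤ (f≤g 0<x) (∏-mono-≤ f g ps f≤g)

*-mono-≤-≡⇒≡ : ∀ {a A b B} → a ≤ A → b ≤ B → 0 < a → 0 < b → a * b ≡ A * B → a ≡ A × b ≡ B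
*-mono-≤-≡⇒≡ {a} {A} {b} {B} a≤A b≤B 0<a 0<b ab≡AB with m≤n⇒m<n∨m≡n a≤A
... | inj₂ a≡A = a≡A , *-cancelˡ-≡ b B A {{>-nonZero (<-≤-trans 0<a a≤A)}} (trans (cong (_* b) (sym a≡A)) ab≡AB)
... | inj₁ a<A = contradiction ab≡AB
      (<⇒≢ (≤-<-trans (*-monoʳ-≤ a b≤B) (*-monoˡ-< B {{>-nonZero (<-≤-trans 0<b b≤B)}} a<A)))

∏≡∏⇒All≡ : ∀ {L} f g → AllPositive L → (∀ {x} → 0 < x → f x ≤ g x) → (∀ {x} → 0 < x → 0 < f x) →
           ∏ L f ≡ ∏ L g → All (λ x → f x ≡ g x) L
∏≡∏⇒All≡ f g []         _   _   _ = []
∏≡∏⇒All≡ f g (0<x ∷ ps) f≤g f>0 eq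
  with *-mono-≤-≡⇒≡ (f≤g 0<x) (∏-mono-≤ f g ps f≤g) (f>0 0<x) (∏-positive f ps f>0) eq
... | fx≡gx , rest = fx≡gx ∷ ∏≡∏⇒All≡ f g ps f≤g f>0 rest

∏-cong : ∀ {L} f g → All (λ x → f x ≡ g x) L → ∏ L f ≡ ∏ L g
∏-cong f g []             = refl
∏-cong f g (fx≡gx ∷ rest) = cong₂ _*_ fx≡gx (∏-cong f g rest)

∏-^ : ∀ c h L → ∏ L (λ x → c ^ h x) ≡ c ^ ∑ L h
∏-^ c h []      = refl
∏-^ c h (x ∷ L) rewrite ∏-^ c h L = sym (^-distribˡ-+-* c (h x) _)

∏-^-sum : ∀ c L → ∏ L (c ^_) ≡ c ^ sum L
∏-^-sum c L = trans (∏-^ c (λ x → x) L) (cong (λ xs → c ^ sum xs) (map-id L))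

∏-* : ∀ f g L → ∏ L (λ x → f x * g x) ≡ ∏ L f * ∏ L g
∏-* f g []      = refl
∏-* f g (x ∷ L) rewrite ∏-* f g L =
  solve 4 (λ a b c d → a :* b :* (c :* d) := a :* c :* (b :* d)) refl (f x) (g x) (∏ L f) (∏ L g)

∏-++ : ∀ f L M → ∏ (L ++ M) f ≡ ∏ L f * ∏ M f
∏-++ f L M = trans (cong product (map-++ f L M)) (product-++ (map f L) (map f M))

∏-replicate : ∀ f n x → ∏ (replicate n x) f ≡ f x ^ n
∏-replicate f zero    x = refl
∏-replicate f (suc n) x = cong (f x *_) (∏-replicate f n x)

∏-↭ : ∀ f {L M} → L ↭ M → ∏ L f ≡ ∏ M f
∏-↭ f L↭M = product-↭ (↭.map⁺ f L↭M)

sum-replicate-1 : ∀ n → sum (replicate n 1) ≡ n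
sum-replicate-1 zero    = refl
sum-replicate-1 (suc n) = cong suc (sum-replicate-1 n)

sum-replicate-2 : ∀ j → sum (replicate j 2) ≡ 2 * j
sum-replicate-2 zero    = refl
sum-replicate-2 (suc j) rewrite sum-replicate-2 j =
  solve 1 (λ j → con 2 :+ con 2 :* j := con 2 :* (con 1 :+ j)) refl j

sizes-positive : ∀ {k n} (λp : KColPart k n) → AllPositive (sizes λp)
sizes-positive λp = map⁺ (proj₁ (proj₂ λp))

sum-sizes : ∀ {k n} (λp : KColPart k n) → sum (sizes λp) ≡ n
sum-sizes λp = proj₂ (proj₂ λp)

monochromatic : ∀ {k n} → Fin k → (xs : List ℕ) → AllPositive xs → sum xs ≡ n →
                Σ (KColPart k n) (λ λp → sizes λp ≡ xs)
monochromatic c xs ps Σxs≡n =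
  (map (_, c) xs , positive xs ps , trans (cong sum (sizes-colored xs)) Σxs≡n) , sizes-colored xs
  where
  sizes-colored : ∀ xs → map proj₁ (map (_, c) xs) ≡ xs
  sizes-colored []       = refl
  sizes-colored (x ∷ xs) = cong (x ∷_) (sizes-colored xs)
  positive : ∀ xs → AllPositive xs → All (λ p → 1 ≤ proj₁ p) (map (_, c) xs)
  positive []       []         = []
  positive (x ∷ xs) (0<x ∷ ps) = 0<x ∷ positive xs ps

module ExponentialPartBound {k} (c : ℕ) (p₋≤c^ : ∀ x → p₋ (suc k) x ≤ c ^ x) where

  p₋part≤^ : ∀ {n} (λp : KColPart (suc k) n) → p₋part λp ≤ c ^ n
  p₋part≤^ {n} λp = begin
    p₋part λp              ≤⟨ ∏-mono-≤ (p₋ (suc k)) (c ^_) (sizes-positive λp) (λ {x} _ → p₋≤c^ x) ⟩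
    ∏ (sizes λp) (c ^_)    ≡⟨ ∏-^-sum c (sizes λp) ⟩
    c ^ sum (sizes λp)     ≡⟨ cong (c ^_) (sum-sizes λp) ⟩
    c ^ n                  ∎
    where open ≤-Reasoning

  p₋part≡^⇔All : ∀ {n} (λp : KColPart (suc k) n) →
                 p₋part λp ≡ c ^ n ⇔ All (λ x → p₋ (suc k) x ≡ c ^ x) (sizes λp)
  p₋part≡^⇔All {n} λp = mk⇔
    (λ eq → ∏≡∏⇒All≡ (p₋ (suc k)) (c ^_) (sizes-positive λp) (λ {x} _ → p₋≤c^ x) (λ {x} _ → p₋-positive k x)
              (trans eq (sym ∏c^≡c^n)))
    (λ all → trans (∏-cong (p₋ (suc k)) (c ^_) all) ∏c^≡c^n)
    where
    ∏c^≡c^n : ∏ (sizes λp) (c ^_) ≡ c ^ n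
    ∏c^≡c^n = trans (∏-^-sum c (sizes λp)) (cong (c ^_) (sum-sizes λp))

  maxAttainedExactly : ∀ n (Shape : List ℕ → Set) → p₋ (suc k) 1 ≡ c ^ 1 →
    (∀ (λp : KColPart (suc k) n) → All (λ x → p₋ (suc k) x ≡ c ^ x) (sizes λp) ⇔ Shape (sizes λp)) →
    MaxAttainedExactly (suc k) n (c ^ n) Shape
  maxAttainedExactly n Shape p₋1≡c all⇔shape =
    (proj₁ ones , Equivalence.from (p₋part≡^⇔All (proj₁ ones))
                    (subst (All _) (sym (proj₂ ones)) (replicate⁺ n p₋1≡c))) ,
    p₋part≤^ ,
    λ λp → all⇔shape λp ⇔-∘ p₋part≡^⇔All λp
    where
    ones : Σ (KColPart (suc k) n) (λ λp → sizes λp ≡ replicate n 1)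
    ones = monochromatic Fin.zero (replicate n 1) (replicate⁺ n (s≤s z≤n)) (sum-replicate-1 n)

All≡1⇒≡replicate : ∀ xs → All (_≡ 1) xs → xs ≡ replicate (sum xs) 1
All≡1⇒≡replicate []       []          = refl
All≡1⇒≡replicate (x ∷ xs) (refl ∷ ps) = cong (1 ∷_) (All≡1⇒≡replicate xs ps)

maxAttainedExactly-≥4 : ∀ k n → 4 ≤ k → MaxAttainedExactly k n (k ^ n) (λ ss → ss ↭ replicate n 1)
maxAttainedExactly-≥4 k@(suc (suc (suc (suc u)))) n (s≤s (s≤s (s≤s (s≤s z≤n)))) =
  maxAttainedExactly n (λ ss → ss ↭ replicate n 1) p₋k1≡k
    (λ λp → mk⇔ (only-ones λp) (λ ss↭1s → All-resp-↭ (↭-sym ss↭1s) (replicate⁺ n p₋k1≡k)))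
  where
  open ExponentialPartBound {3 + u} k (p₋≤^ u)
  p₋k1≡k : p₋ k 1 ≡ k ^ 1
  p₋k1≡k = trans (p₋-one k) (sym (*-identityʳ k))
  part≡1 : ∀ {x} → 0 < x × p₋ k x ≡ k ^ x → x ≡ 1
  part≡1 {1}           _        = refl
  part≡1 {suc (suc j)} (_ , eq) = contradiction eq (<⇒≢ (p₋<^ u j))
  only-ones : ∀ (λp : KColPart k n) → All (λ x → p₋ k x ≡ k ^ x) (sizes λp) → sizes λp ↭ replicate n 1
  only-ones λp all = ↭-reflexive (begin
    sizes λp                        ≡⟨ All≡1⇒≡replicate (sizes λp) (All.zipWith part≡1 (sizes-positive λp , all)) ⟩
    replicate (sum (sizes λp)) 1    ≡⟨ cong (λ s → replicate s 1) (sum-sizes λp) ⟩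
    replicate n 1                   ∎)
    where open ≡-Reasoning

twos-and-ones : ∀ xs → All (λ x → x ≡ 1 ⊎ x ≡ 2) xs →
                ∃₂ λ m l → (2 * m + l ≡ sum xs) × xs ↭ (replicate m 2 ++ replicate l 1)
twos-and-ones []       []               = 0 , 0 , refl , ↭-refl
twos-and-ones (x ∷ xs) (inj₂ refl ∷ ps) with twos-and-ones xs ps
... | m , l , eq , xs↭ = suc m , l ,
  trans (solve 2 (λ m l → con 2 :* (con 1 :+ m) :+ l := con 2 :+ (con 2 :* m :+ l)) refl m l) (cong (2 +_) eq) ,
  prep 2 xs↭
twos-and-ones (x ∷ xs) (inj₁ refl ∷ ps) with twos-and-ones xs ps
... | m , l , eq , xs↭ = m , suc l , trans (+-suc (2 * m) l) (cong suc eq) ,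
  ↭-trans (prep 1 xs↭) (↭-sym (↭.shift 1 (replicate m 2) (replicate l 1)))

maxAttainedExactly-3 : ∀ n → MaxAttainedExactly 3 n (3 ^ n)
  (λ ss → ∃₂ λ m l → (2 * m + l ≡ n) × ss ↭ (replicate m 2 ++ replicate l 1))
maxAttainedExactly-3 n = maxAttainedExactly n Shape refl (λ λp → mk⇔ (to λp) from)
  where
  open ExponentialPartBound {2} 3 p₋₃≤3^
  Shape : List ℕ → Set
  Shape ss = ∃₂ λ m l → (2 * m + l ≡ n) × ss ↭ (replicate m 2 ++ replicate l 1)
  part∈12 : ∀ {x} → 0 < x × p₋ 3 x ≡ 3 ^ x → x ≡ 1 ⊎ x ≡ 2
  part∈12 {1}                 _        = inj₁ refl
  part∈12 {2}                 _        = inj₂ refl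
  part∈12 {suc (suc (suc j))} (_ , eq) = contradiction eq (<⇒≢ (p₋₃<3^ j))
  to : ∀ (λp : KColPart 3 n) → All (λ x → p₋ 3 x ≡ 3 ^ x) (sizes λp) → Shape (sizes λp)
  to λp all with twos-and-ones (sizes λp) (All.zipWith part∈12 (sizes-positive λp , all))
  ... | m , l , eq , ss↭ = m , l , trans eq (sum-sizes λp) , ss↭
  from : ∀ {ss} → Shape ss → All (λ x → p₋ 3 x ≡ 3 ^ x) ss
  from (m , l , _ , ss↭) = All-resp-↭ (↭-sym ss↭) (++⁺ (replicate⁺ m refl) (replicate⁺ l refl))

-- Two colors

notTwo : ℕ → ℕ
notTwo 2 = 0
notTwo _ = 1

-- The k = 2 comparison weighs each part size x by [x ≠ 2]: 5^[x≠2] p₋₂(x)² ≤ 4^[x≠2] 5^x,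
-- with equality exactly for x ∈ {1, 2, 3}.
weightedSquare : ℕ → ℕ
weightedSquare x = 5 ^ notTwo x * (p₋ 2 x * p₋ 2 x)

weightedPower : ℕ → ℕ
weightedPower x = 4 ^ notTwo x * 5 ^ x

weightedSquare≤weightedPower : ∀ {x} → 0 < x → weightedSquare x ≤ weightedPower x
weightedSquare≤weightedPower {1}                       _ = ≤-refl
weightedSquare≤weightedPower {2}                       _ = ≤-refl
weightedSquare≤weightedPower {3}                       _ = ≤-refl
weightedSquare≤weightedPower {suc (suc (suc (suc j)))} _ = <⇒≤ (5*p₋₂²<4*5^ j)

weightedSquare≡weightedPower⇒≤3 : ∀ {x} → 0 < x × weightedSquare x ≡ weightedPower x → x ≡ 1 ⊎ x ≡ 2 ⊎ x ≡ 3
weightedSquare≡weightedPower⇒≤3 {1}                       _        = inj₁ refl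
weightedSquare≡weightedPower⇒≤3 {2}                       _        = inj₂ (inj₁ refl)
weightedSquare≡weightedPower⇒≤3 {3}                       _        = inj₂ (inj₂ refl)
weightedSquare≡weightedPower⇒≤3 {suc (suc (suc (suc j)))} (_ , eq) = contradiction eq (<⇒≢ (5*p₋₂²<4*5^ j))

weightedSquare-positive : ∀ {x} → 0 < x → 0 < weightedSquare x
weightedSquare-positive {x} _ = *-mono-< (m^n>0 5 (notTwo x)) (*-mono-< (p₋-positive 1 x) (p₋-positive 1 x))

∏-weightedSquare : ∀ xs → ∏ xs weightedSquare ≡ 5 ^ ∑ xs notTwo * (∏ xs (p₋ 2) * ∏ xs (p₋ 2))
∏-weightedSquare xs = trans (∏-* (λ x → 5 ^ notTwo x) (λ x → p₋ 2 x * p₋ 2 x) xs)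
                            (cong₂ _*_ (∏-^ 5 notTwo xs) (∏-* (p₋ 2) (p₋ 2) xs))

∏-weightedPower : ∀ xs → ∏ xs weightedPower ≡ 4 ^ ∑ xs notTwo * 5 ^ sum xs
∏-weightedPower xs = trans (∏-* (λ x → 4 ^ notTwo x) (5 ^_) xs) (cong₂ _*_ (∏-^ 4 notTwo xs) (∏-^-sum 5 xs))

notTwos : ∀ {k n} → KColPart k n → ℕ
notTwos λp = ∑ (sizes λp) notTwo

p₋₂part-weighted-bound : ∀ {n} (λp : KColPart 2 n) →
  5 ^ notTwos λp * (p₋part λp * p₋part λp) ≤ 4 ^ notTwos λp * 5 ^ n
p₋₂part-weighted-bound {n} λp = begin
  5 ^ notTwos λp * (p₋part λp * p₋part λp) ≡⟨ ∏-weightedSquare xs ⟨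
  ∏ xs weightedSquare                      ≤⟨ ∏-mono-≤ weightedSquare weightedPower (sizes-positive λp) weightedSquare≤weightedPower ⟩
  ∏ xs weightedPower                       ≡⟨ ∏-weightedPower xs ⟩
  4 ^ notTwos λp * 5 ^ sum xs              ≡⟨ cong (λ s → 4 ^ notTwos λp * 5 ^ s) (sum-sizes λp) ⟩
  4 ^ notTwos λp * 5 ^ n                   ∎
  where
  open ≤-Reasoning
  xs = sizes λp

4^≤5^ : ∀ b → 4 ^ b ≤ 5 ^ b
4^≤5^ b = ^-monoˡ-≤ b (n≤1+n 4)

4^<5^ : ∀ c → 4 ^ suc c < 5 ^ suc c
4^<5^ c = ^-monoˡ-< (suc c) (n<1+n 4)

5^*≤4^*⇒≤ : ∀ b X Y → 5 ^ b * X ≤ 4 ^ b * Y → X ≤ Y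
5^*≤4^*⇒≤ b X Y h = *-cancelˡ-≤ (5 ^ b) {{m^n≢0 5 b}} (≤-trans h (*-monoˡ-≤ Y (4^≤5^ b)))

5^*≤4^*⇒5*≤4* : ∀ c X Y → 5 ^ suc c * X ≤ 4 ^ suc c * Y → 5 * X ≤ 4 * Y
5^*≤4^*⇒5*≤4* c X Y h = 5^*≤4^*⇒≤ c (5 * X) (4 * Y) (begin
  5 ^ c * (5 * X)     ≡⟨ solve 2 (λ a x → a :* (con 5 :* x) := con 5 :* a :* x) refl (5 ^ c) X ⟩
  5 ^ suc c * X       ≤⟨ h ⟩
  4 ^ suc c * Y       ≡⟨ solve 2 (λ a y → con 4 :* a :* y := a :* (con 4 :* y)) refl (4 ^ c) Y ⟩
  4 ^ c * (4 * Y)     ∎)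
  where open ≤-Reasoning

5^*≤4^*⇒5*<4* : ∀ c X Y → 0 < Y → 5 ^ suc (suc c) * X ≤ 4 ^ suc (suc c) * Y → 5 * X < 4 * Y
5^*≤4^*⇒5*<4* c X Y 0<Y h = *-cancelˡ-< (5 ^ suc c) _ _ (begin-strict
  5 ^ suc c * (5 * X)    ≡⟨ solve 2 (λ a x → a :* (con 5 :* x) := con 5 :* a :* x) refl (5 ^ suc c) X ⟩
  5 ^ suc (suc c) * X    ≤⟨ h ⟩
  4 ^ suc (suc c) * Y    ≡⟨ solve 2 (λ a y → con 4 :* a :* y := con 4 :* (a :* y)) refl (4 ^ suc c) Y ⟩
  4 * (4 ^ suc c * Y)    <⟨ *-monoʳ-< 4 (*-monoˡ-< Y {{>-nonZero 0<Y}} (4^<5^ c)) ⟩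
  4 * (5 ^ suc c * Y)    ≡⟨ solve 2 (λ a y → con 4 :* (a :* y) := a :* (con 4 :* y)) refl (5 ^ suc c) Y ⟩
  5 ^ suc c * (4 * Y)    ∎)
  where open ≤-Reasoning

m*m≤n*n⇒m≤n : ∀ m n → m * m ≤ n * n → m ≤ n
m*m≤n*n⇒m≤n m n m²≤n² with m ≤? n
... | yes m≤n = m≤n
... | no  m≰n = contradiction m²≤n² (<⇒≱ (*-mono-< (≰⇒> m≰n) (≰⇒> m≰n)))

^-double : ∀ c m → c ^ (2 * m) ≡ c ^ m * c ^ m
^-double c m = trans (^-distribˡ-+-* c m (m + 0)) (cong (λ e → c ^ m * c ^ e) (+-identityʳ m))

notTwo-free⇒≡replicate : ∀ xs → ∑ xs notTwo ≡ 0 → xs ≡ replicate (length xs) 2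
notTwo-free⇒≡replicate []                        _  = refl
notTwo-free⇒≡replicate (2 ∷ xs)                  eq = cong (2 ∷_) (notTwo-free⇒≡replicate xs eq)
notTwo-free⇒≡replicate (0 ∷ xs)                  ()
notTwo-free⇒≡replicate (1 ∷ xs)                  ()
notTwo-free⇒≡replicate (suc (suc (suc x)) ∷ xs)  ()

notTwo-free⇒even : ∀ xs → ∑ xs notTwo ≡ 0 → sum xs ≡ 2 * length xs
notTwo-free⇒even xs eq = trans (cong sum (notTwo-free⇒≡replicate xs eq)) (sum-replicate-2 (length xs))

OddShape : List ℕ → Set
OddShape ss = (∃ λ j → ss ↭ (3 ∷ replicate j 2)) ⊎ (∃ λ j → ss ↭ (replicate j 2 ++ (1 ∷ [])))

oddShape : ∀ xs → All (λ x → x ≡ 1 ⊎ x ≡ 2 ⊎ x ≡ 3) xs → ∑ xs notTwo ≡ 1 → OddShape xs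
oddShape []       []                      ()
oddShape (x ∷ xs) (inj₂ (inj₁ refl) ∷ ps) eq with oddShape xs ps eq
... | inj₁ (j , xs↭) = inj₁ (suc j , ↭-trans (prep 2 xs↭) (swap 2 3 ↭-refl))
... | inj₂ (j , xs↭) = inj₂ (suc j , prep 2 xs↭)
oddShape (x ∷ xs) (inj₁ refl ∷ ps)        eq rewrite notTwo-free⇒≡replicate xs (suc-injective eq) =
  inj₂ (length xs , ↭.++-comm (1 ∷ []) (replicate (length xs) 2))
oddShape (x ∷ xs) (inj₂ (inj₂ refl) ∷ ps) eq rewrite notTwo-free⇒≡replicate xs (suc-injective eq) =
  inj₁ (length xs , ↭-refl)

maxAttainedExactly-2-even : ∀ m → MaxAttainedExactly 2 (2 * m) (5 ^ m) (λ ss → ss ↭ replicate m 2)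
maxAttainedExactly-2-even m = attained , p₋part≤5^ , λ λp → mk⇔ (only-twos λp) (twos λp)
  where
  twos : ∀ (λp : KColPart 2 (2 * m)) → sizes λp ↭ replicate m 2 → p₋part λp ≡ 5 ^ m
  twos λp ss↭ = trans (∏-↭ (p₋ 2) ss↭) (∏-replicate (p₋ 2) m 2)
  attained : ∃ λ (λp : KColPart 2 (2 * m)) → p₋part λp ≡ 5 ^ m
  attained with monochromatic Fin.zero (replicate m 2) (replicate⁺ m (s≤s z≤n)) (sum-replicate-2 m)
  ... | λp , ss≡ = λp , twos λp (↭-reflexive ss≡)
  p₋part≤5^ : ∀ (λp : KColPart 2 (2 * m)) → p₋part λp ≤ 5 ^ m
  p₋part≤5^ λp = m*m≤n*n⇒m≤n _ _ (subst (p₋part λp * p₋part λp ≤_) (^-double 5 m)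
                   (5^*≤4^*⇒≤ (notTwos λp) _ _ (p₋₂part-weighted-bound λp)))
  only-twos : ∀ (λp : KColPart 2 (2 * m)) → p₋part λp ≡ 5 ^ m → sizes λp ↭ replicate m 2
  only-twos λp eq with notTwos λp in b≡
  ... | zero = ↭-reflexive (trans (notTwo-free⇒≡replicate xs b≡) (cong (λ z → replicate z 2) length≡m))
    where
    xs = sizes λp
    length≡m : length xs ≡ m
    length≡m = *-cancelˡ-≡ (length xs) m 2 (trans (sym (notTwo-free⇒even xs b≡)) (sum-sizes λp))
  ... | suc c = contradiction (5^*≤4^*⇒5*≤4* c X X (subst (λ b → 5 ^ b * X ≤ 4 ^ b * X) b≡ bound))
                             (<⇒≱ (*-monoˡ-< X {{>-nonZero X>0}} (n<1+n 4)))
    where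
    X = p₋part λp * p₋part λp
    X≡5^2m : X ≡ 5 ^ (2 * m)
    X≡5^2m = trans (cong₂ _*_ eq eq) (sym (^-double 5 m))
    X>0 : 0 < X
    X>0 = subst (0 <_) (sym X≡5^2m) (m^n>0 5 (2 * m))
    bound : 5 ^ notTwos λp * X ≤ 4 ^ notTwos λp * X
    bound = subst (λ Y → 5 ^ notTwos λp * X ≤ 4 ^ notTwos λp * Y) (sym X≡5^2m) (p₋₂part-weighted-bound λp)

p₋part-oddShape : ∀ m (λp : KColPart 2 (2 * m + 1)) → OddShape (sizes λp) → p₋part λp ≡ 2 * 5 ^ m
p₋part-oddShape m λp (inj₁ (j , ss↭)) = begin
  p₋part λp                   ≡⟨ ∏-↭ (p₋ 2) ss↭ ⟩
  10 * ∏ (replicate j 2) (p₋ 2) ≡⟨ cong (10 *_) (∏-replicate (p₋ 2) j 2) ⟩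
  10 * 5 ^ j                  ≡⟨ solve 1 (λ a → con 10 :* a := con 2 :* (con 5 :* a)) refl (5 ^ j) ⟩
  2 * 5 ^ suc j               ≡⟨ cong (λ e → 2 * 5 ^ e) m≡1+j ⟨
  2 * 5 ^ m                   ∎
  where
  open ≡-Reasoning
  m≡1+j : m ≡ suc j
  m≡1+j = *-cancelˡ-≡ m (suc j) 2 (+-cancelʳ-≡ 1 _ _ (begin
    2 * m + 1                 ≡⟨ sum-sizes λp ⟨
    sum (sizes λp)            ≡⟨ sum-↭ ss↭ ⟩
    3 + sum (replicate j 2)   ≡⟨ cong (3 +_) (sum-replicate-2 j) ⟩
    3 + 2 * j                 ≡⟨ solve 1 (λ j → con 3 :+ con 2 :* j := con 2 :* (con 1 :+ j) :+ con 1) refl j ⟩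
    2 * suc j + 1             ∎))
p₋part-oddShape m λp (inj₂ (j , ss↭)) = begin
  p₋part λp                                        ≡⟨ ∏-↭ (p₋ 2) ss↭ ⟩
  ∏ (replicate j 2 ++ 1 ∷ []) (p₋ 2)               ≡⟨ ∏-++ (p₋ 2) (replicate j 2) (1 ∷ []) ⟩
  ∏ (replicate j 2) (p₋ 2) * 2                     ≡⟨ cong (_* 2) (∏-replicate (p₋ 2) j 2) ⟩
  5 ^ j * 2                                        ≡⟨ *-comm (5 ^ j) 2 ⟩
  2 * 5 ^ j                                        ≡⟨ cong (λ e → 2 * 5 ^ e) m≡j ⟨
  2 * 5 ^ m                                        ∎
  where
  open ≡-Reasoning
  m≡j : m ≡ j
  m≡j = *-cancelˡ-≡ m j 2 (+-cancelʳ-≡ 1 _ _ (begin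
    2 * m + 1                             ≡⟨ sum-sizes λp ⟨
    sum (sizes λp)                        ≡⟨ sum-↭ ss↭ ⟩
    sum (replicate j 2 ++ 1 ∷ [])         ≡⟨ sum-++ (replicate j 2) (1 ∷ []) ⟩
    sum (replicate j 2) + 1               ≡⟨ cong (_+ 1) (sum-replicate-2 j) ⟩
    2 * j + 1                             ∎))

maxAttainedExactly-2-odd : ∀ m → MaxAttainedExactly 2 (2 * m + 1) (2 * 5 ^ m) OddShape
maxAttainedExactly-2-odd m = attained , p₋part≤2*5^ , λ λp → mk⇔ (to λp) (p₋part-oddShape m λp)
  where
  n = 2 * m + 1
  Z = 4 * 5 ^ (2 * m)
  4*5^n≡5*Z : 4 * 5 ^ n ≡ 5 * Z
  4*5^n≡5*Z = trans (cong (4 *_) (^-distribˡ-+-* 5 (2 * m) 1))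
                    (solve 1 (λ a → con 4 :* (a :* (con 5 :* con 1)) := con 5 :* (con 4 :* a)) refl (5 ^ (2 * m)))
  Z≡[2*5^m]² : Z ≡ (2 * 5 ^ m) * (2 * 5 ^ m)
  Z≡[2*5^m]² = trans (cong (4 *_) (^-double 5 m))
                     (solve 1 (λ a → con 4 :* (a :* a) := (con 2 :* a) :* (con 2 :* a)) refl (5 ^ m))
  some-notTwo : ∀ (λp : KColPart 2 n) → notTwos λp ≢ 0
  some-notTwo λp b≡0 = even≢odd (length (sizes λp)) m
    (trans (sym (notTwo-free⇒even (sizes λp) b≡0)) (trans (sum-sizes λp) (+-comm (2 * m) 1)))
  weighted-bound : ∀ (λp : KColPart 2 n) {b} → notTwos λp ≡ b →
                   5 ^ b * (p₋part λp * p₋part λp) ≤ 4 ^ b * 5 ^ n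
  weighted-bound λp b≡ = subst (λ b → 5 ^ b * (p₋part λp * p₋part λp) ≤ 4 ^ b * 5 ^ n) b≡ (p₋₂part-weighted-bound λp)
  p₋part²≤Z : ∀ (λp : KColPart 2 n) → p₋part λp * p₋part λp ≤ Z
  p₋part²≤Z λp with notTwos λp in b≡
  ... | zero  = contradiction b≡ (some-notTwo λp)
  ... | suc c = *-cancelˡ-≤ 5 (subst (5 * (p₋part λp * p₋part λp) ≤_) 4*5^n≡5*Z
                  (5^*≤4^*⇒5*≤4* c _ _ (weighted-bound λp b≡)))
  p₋part≤2*5^ : ∀ (λp : KColPart 2 n) → p₋part λp ≤ 2 * 5 ^ m
  p₋part≤2*5^ λp = m*m≤n*n⇒m≤n _ _ (subst (p₋part λp * p₋part λp ≤_) Z≡[2*5^m]² (p₋part²≤Z λp))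
  attained : ∃ λ (λp : KColPart 2 n) → p₋part λp ≡ 2 * 5 ^ m
  attained with monochromatic Fin.zero (replicate m 2 ++ 1 ∷ []) (++⁺ (replicate⁺ m (s≤s z≤n)) (s≤s z≤n ∷ []))
                  (trans (sum-++ (replicate m 2) (1 ∷ [])) (cong (_+ 1) (sum-replicate-2 m)))
  ... | λp , ss≡ = λp , p₋part-oddShape m λp (inj₂ (m , ↭-reflexive ss≡))
  to : ∀ (λp : KColPart 2 n) → p₋part λp ≡ 2 * 5 ^ m → OddShape (sizes λp)
  to λp eq with notTwos λp in b≡
  ... | zero        = contradiction b≡ (some-notTwo λp)
  ... | suc (suc c) = contradiction (trans (cong (5 *_) P²≡Z) (sym 4*5^n≡5*Z))
                        (<⇒≢ (5^*≤4^*⇒5*<4* c _ _ (m^n>0 5 n) (weighted-bound λp b≡)))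
    where
    P²≡Z : p₋part λp * p₋part λp ≡ Z
    P²≡Z = trans (cong₂ _*_ eq eq) (sym Z≡[2*5^m]²)
  ... | suc zero    = oddShape xs (All.zipWith weightedSquare≡weightedPower⇒≤3 (sizes-positive λp , equalities)) b≡
    where
    xs = sizes λp
    ∏-equal : ∏ xs weightedSquare ≡ ∏ xs weightedPower
    ∏-equal = begin
      ∏ xs weightedSquare                           ≡⟨ ∏-weightedSquare xs ⟩
      5 ^ notTwos λp * (p₋part λp * p₋part λp)      ≡⟨ cong₂ (λ b P → 5 ^ b * (P * P)) b≡ eq ⟩
      5 ^ 1 * ((2 * 5 ^ m) * (2 * 5 ^ m))           ≡⟨ cong (5 *_) Z≡[2*5^m]² ⟨
      5 * Z                                         ≡⟨ 4*5^n≡5*Z ⟨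
      4 ^ 1 * 5 ^ n                                 ≡⟨ cong₂ (λ b s → 4 ^ b * 5 ^ s) b≡ (sum-sizes λp) ⟨
      4 ^ notTwos λp * 5 ^ sum xs                   ≡⟨ ∏-weightedPower xs ⟨
      ∏ xs weightedPower                            ∎
      where open ≡-Reasoning
    equalities : All (λ x → weightedSquare x ≡ weightedPower x) xs
    equalities = ∏≡∏⇒All≡ weightedSquare weightedPower (sizes-positive λp)
                   weightedSquare≤weightedPower weightedSquare-positive ∏-equal

theorem4p1 :
    -- k = 2, n even (n = 2m ≥ 1)
    (∀ (m : ℕ) → 1 ≤ 2 * m →
       MaxAttainedExactly 2 (2 * m) (5 ^ m)
         (λ ss → ss ↭ replicate m 2))
    -- k = 2, n odd (n = 2m + 1)
    × (∀ (m : ℕ) →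
       MaxAttainedExactly 2 (2 * m + 1) (2 * 5 ^ m)
         (λ ss → (∃ λ j → ss ↭ (3 ∷ replicate j 2))
               ⊎ (∃ λ j → ss ↭ (replicate j 2 ++ (1 ∷ [])))))
    -- k = 3
    × (∀ (n : ℕ) → 1 ≤ n →
       MaxAttainedExactly 3 n (3 ^ n)
         (λ ss → ∃₂ λ m l → (2 * m + l ≡ n) × ss ↭ (replicate m 2 ++ replicate l 1)))
    -- k ≥ 4
    × (∀ (k n : ℕ) → 4 ≤ k → 1 ≤ n →
       MaxAttainedExactly k n (k ^ n)
         (λ ss → ss ↭ replicate n 1))
theorem4p1 =
  (λ m _ → maxAttainedExactly-2-even m) ,
  maxAttainedExactly-2-odd ,
  (λ n _ → maxAttainedExactly-3 n) ,
  (λ k n 4≤k _ → maxAttainedExactly-≥4 k n 4≤k)
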